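{- Consider the problem SMGC with an $\alpha$-approximate oracle $g$ ($\alpha\ge1$). Run the following greedy algorithm: start with $S=\emptyset$; for $k$ rounds, for each group $G_i$ containing no element of $S$ compute $a_i=g(S,G_i)$, and add to $S$ the candidate $a_i$ maximizing $f(S\cup\{a_i\})-f(S)$. Then the output $S$ is feasible and satisfies $f(S)\ge\frac{1}{\alpha+1}f(O^*)$, where $O^*$ is an optimal feasible solution.
   Context: SMGC (Submodular Maximization with Group Constraints and Imperfect Oracle): given a parameter $n$, a ground set $U$ with $|U|=2^{\mathrm{poly}(n)}$, a monotone submodular function $f:2^U\to\mathbb{R}_{\ge0}$, a partition of $U$ into groups $G_1,\dots,G_\ell$ with $\ell=\mathrm{poly}(n)$, and an integer $k$ with $\ell>k$. A set $S\subseteq U$ is feasible if $|S|\le k$ and $S$ contains at most one element from each group. An $\alpha$-approximate oracle $g$ takes a set $S\subseteq U$ and a group $G_i$ and returns in $\mathrm{poly}(n)$ time an element $e^*\in G_i$ with $f(S\cup\{e^*\})-f(S)\ge\frac1\alpha\max_{e\in G_i}\big(f(S\cup\{e\})-f(S)\big)$. The goal is a feasible $S$ maximizing $f(S)$.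
   Formalization: The values of the monotone submodular function f and the parameter α are rational rather than real. -}

module Defs where

open import Data.Nat as ℕ using (ℕ; zero; suc)
open import Data.Fin using (Fin)
open import Data.Fin.Subset as Sub using (Subset; _∈_; _∉_; _⊆_; _∪_; ⁅_⁆; ∣_∣)
open import Data.Rational as ℚ using (ℚ; 0ℚ; 1ℚ; _+_; _*_; _-_)
open import Data.Product using (Σ; _×_)
open import Relation.Binary.PropositionalEquality using (_≡_; _≢_)

gain : {N : ℕ} → (Subset N → ℚ) → Subset N → Fin N → ℚ
gain f S e = f (S ∪ ⁅ e ⁆) - f S

NonNegative : {N : ℕ} → (Subset N → ℚ) → Set
NonNegative f = ∀ S → 0ℚ ℚ.≤ f S

Monotone : {N : ℕ} → (Subset N → ℚ) → Set
Monotone f = ∀ S T → S ⊆ T → f S ℚ.≤ f T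

Submodular : {N : ℕ} → (Subset N → ℚ) → Set
Submodular f = ∀ S T x → S ⊆ T → x ∉ T → gain f T x ℚ.≤ gain f S x

-- The partition of U into groups G_1..G_ℓ is given by  grp : Fin N → Fin ℓ
-- (G_i = { e | grp e ≡ i }).
-- Feasible: |S| ≤ k and at most one element of S in each group.
Feasible : {N ℓ : ℕ} → (Fin N → Fin ℓ) → ℕ → Subset N → Set
Feasible grp k S = (∣ S ∣ ℕ.≤ k) × (∀ x y → x ∈ S → y ∈ S → grp x ≡ grp y → x ≡ y)

IsApproxOracle : {N ℓ : ℕ} → (Subset N → ℚ) → (Fin N → Fin ℓ) → ℚ
               → (Subset N → Fin ℓ → Fin N) → Set
IsApproxOracle f grp α g =
  ∀ S i → (grp (g S i) ≡ i) ×
          (∀ e → grp e ≡ i → gain f S e ℚ.≤ α * gain f S (g S i))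

Untouched : {N ℓ : ℕ} → (Fin N → Fin ℓ) → Subset N → Fin ℓ → Set
Untouched grp S i = ∀ x → x ∈ S → grp x ≢ i

GreedyStep : {N ℓ : ℕ} → (Subset N → ℚ) → (Fin N → Fin ℓ)
           → (Subset N → Fin ℓ → Fin N) → Subset N → Subset N → Set
GreedyStep f grp g S S′ =
  Σ _ λ i → Untouched grp S i ×
            (S′ ≡ S ∪ ⁅ g S i ⁆) ×
            (∀ j → Untouched grp S j → gain f S (g S j) ℚ.≤ gain f S (g S i))

data GreedyRun {N ℓ : ℕ} (f : Subset N → ℚ) (grp : Fin N → Fin ℓ)
               (g : Subset N → Fin ℓ → Fin N) : ℕ → Subset N → Set where
  start : GreedyRun f grp g zero Sub.⊥
  step  : ∀ {m S S′} → GreedyRun f grp g m S → GreedyStep f grp g S S′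
        → GreedyRun f grp g (suc m) S′

{-# OPTIONS --safe #-}
-- If the group of o is still untouched by the greedy set S after some round, the oracle's
-- candidate for that group competed in the next round; by submodularity and the greedy choice,
-- the marginal value of o on any T ⊇ S is then at most α times the gain of that round. Charging
-- each element of a feasible O to a distinct round (the round that touched its group, or else a
-- spare one, which exists as |O| ≤ k) gives f(O) ≤ f(O ∪ S) ≤ f(S) + α (f(S) − f(∅)) ≤ (α+1) f(S).
-- The charging is an induction on the run: after m rounds the bound holds for every one-per-group
-- O that has at most m elements or lies in touched groups; each round either pays for one
-- element of O in a group untouched before it, or O is already paid for.
module Submission where

open import Defs
open import Data.Nat as ℕ using (ℕ; zero; suc; z≤n; s≤s)
import Data.Nat.Properties as ℕP
open import Data.Fin using (Fin)
open import Data.Fin.Properties using (all?; any?) renaming (_≟_ to _≟ᶠ_)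
open import Data.Vec using (_∷_; []; there)
open import Data.Fin.Subset
  using (Subset; inside; outside; _∈_; _∉_; _⊆_; _∪_; _─_; ⁅_⁆; ∣_∣; ∁; ⊤)
  renaming (⊥ to ∅)
open import Data.Fin.Subset.Properties
  using ( _∈?_; ∉⊥; p⊆p∪q; q⊆p∪q; x∈p∪q⁻; x∈⁅x⁆; x∈⁅y⁆⇒x≡y; ∣⁅x⁆∣≡1; ∣⊥∣≡0; ∣⊤∣≡n
        ; p⊆q⇒∣p∣≤∣q∣; nonempty?; x∈∁p⇒x∉p; x∉∁p⇒x∈p; p─q⊆p; x∈p∧x≢y⇒x∈p-y
        ; x∈p⇒∣p-x∣<∣p∣ )
open import Data.Rational as ℚ using (ℚ; 0ℚ; 1ℚ; _+_; _*_; _-_; -_)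
import Data.Rational.Properties as ℚP
open import Data.Rational.Solver using (module +-*-Solver)
open import Data.List using (List; allFin; filter)
open import Data.List.Relation.Unary.All using (lookup)
open import Data.List.Relation.Unary.All.Properties using (all-filter)
open import Data.List.Membership.Propositional.Properties using (∈-allFin; ∈-filter⁺)
import Data.List.Extrema
open import Data.Product as Product using (Σ; ∃; _×_; _,_; proj₁; proj₂)
open import Data.Sum as Sum using (_⊎_; inj₁; inj₂)
open import Function using (_∘_)
open import Relation.Binary.Bundles using (DecTotalOrder)
open import Relation.Nullary using (¬_; Dec; yes; no; contradiction)
open import Relation.Nullary.Decidable using (_×-dec_; _→-dec_; ¬?)
open import Relation.Binary.PropositionalEquality


∣p∪q∣≤∣p∣+∣q∣ : ∀ {n} (p q : Subset n) → ∣ p ∪ q ∣ ℕ.≤ ∣ p ∣ ℕ.+ ∣ q ∣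
∣p∪q∣≤∣p∣+∣q∣ []            []            = z≤n
∣p∪q∣≤∣p∣+∣q∣ (outside ∷ p) (outside ∷ q) = ∣p∪q∣≤∣p∣+∣q∣ p q
∣p∪q∣≤∣p∣+∣q∣ (outside ∷ p) (inside ∷ q)  =
  ℕP.≤-trans (s≤s (∣p∪q∣≤∣p∣+∣q∣ p q)) (ℕP.≤-reflexive (sym (ℕP.+-suc ∣ p ∣ ∣ q ∣)))
∣p∪q∣≤∣p∣+∣q∣ (inside ∷ p)  (outside ∷ q) = s≤s (∣p∪q∣≤∣p∣+∣q∣ p q)
∣p∪q∣≤∣p∣+∣q∣ (inside ∷ p)  (inside ∷ q)  =
  s≤s (ℕP.≤-trans (∣p∪q∣≤∣p∣+∣q∣ p q) (ℕP.+-monoʳ-≤ ∣ p ∣ (ℕP.n≤1+n ∣ q ∣)))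

∣p∪⁅x⁆∣≤1+∣p∣ : ∀ {n} (p : Subset n) x → ∣ p ∪ ⁅ x ⁆ ∣ ℕ.≤ suc ∣ p ∣
∣p∪⁅x⁆∣≤1+∣p∣ p x = begin
  ∣ p ∪ ⁅ x ⁆ ∣         ≤⟨ ∣p∪q∣≤∣p∣+∣q∣ p ⁅ x ⁆ ⟩
  ∣ p ∣ ℕ.+ ∣ ⁅ x ⁆ ∣   ≡⟨ cong (∣ p ∣ ℕ.+_) (∣⁅x⁆∣≡1 x) ⟩
  ∣ p ∣ ℕ.+ 1           ≡⟨ ℕP.+-comm ∣ p ∣ 1 ⟩
  suc ∣ p ∣             ∎
  where open ℕP.≤-Reasoning

x∈p∪⁅y⁆⁻ : ∀ {n} {p : Subset n} {x y} → x ∈ p ∪ ⁅ y ⁆ → x ∈ p ⊎ x ≡ y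
x∈p∪⁅y⁆⁻ {p = p} {y = y} = Sum.map₂ (x∈⁅y⁆⇒x≡y y) ∘ x∈p∪q⁻ p ⁅ y ⁆

x∈p─q⇒x∉q : ∀ {n} {p q : Subset n} {x} → x ∈ p ─ q → x ∉ q
x∈p─q⇒x∉q {p = _ ∷ _} {q = outside ∷ _} (there x∈p─q) (there x∈q) = x∈p─q⇒x∉q x∈p─q x∈q
x∈p─q⇒x∉q {p = _ ∷ _} {q = inside ∷ _}  (there x∈p─q) (there x∈q) = x∈p─q⇒x∉q x∈p─q x∈q

x∈p-y⇒x≢y : ∀ {n} {p : Subset n} {x y} → x ∈ p ─ ⁅ y ⁆ → x ≢ y
x∈p-y⇒x≢y x∈p-y refl = x∈p─q⇒x∉q x∈p-y (x∈⁅x⁆ _)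

x∈p⇒p∪⁅x⁆⊆p : ∀ {n} {p : Subset n} {x} → x ∈ p → p ∪ ⁅ x ⁆ ⊆ p
x∈p⇒p∪⁅x⁆⊆p x∈p y∈p∪⁅x⁆ with x∈p∪⁅y⁆⁻ y∈p∪⁅x⁆
... | inj₁ y∈p = y∈p
... | inj₂ refl = x∈p

p∪q⊆[p-x∪q]∪⁅x⁆ : ∀ {n} (p q : Subset n) x → p ∪ q ⊆ ((p ─ ⁅ x ⁆) ∪ q) ∪ ⁅ x ⁆
p∪q⊆[p-x∪q]∪⁅x⁆ p q x {y} y∈p∪q with y ≟ᶠ x | x∈p∪q⁻ p q y∈p∪q
... | yes refl | _        = q⊆p∪q _ _ (x∈⁅x⁆ x)
... | no y≢x   | inj₁ y∈p = p⊆p∪q _ (p⊆p∪q q (x∈p∧x≢y⇒x∈p-y y∈p y≢x))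
... | no _     | inj₂ y∈q = p⊆p∪q _ (q⊆p∪q _ q y∈q)

∣p∣<n⇒∃∉ : ∀ {n} (p : Subset n) → ∣ p ∣ ℕ.< n → ∃ (_∉ p)
∣p∣<n⇒∃∉ {n} p ∣p∣<n with nonempty? (∁ p)
... | yes (x , x∈∁p) = x , x∈∁p⇒x∉p x∈∁p
... | no ∁p-empty    =
  contradiction (subst (ℕ._≤ ∣ p ∣) (∣⊤∣≡n n) (p⊆q⇒∣p∣≤∣q∣ ⊤⊆p)) (ℕP.<⇒≱ ∣p∣<n)
  where
  ⊤⊆p : ⊤ ⊆ p
  ⊤⊆p {x} _ = x∉∁p⇒x∈p (∁p-empty ∘ (x ,_))

p≤q⇒0≤q-p : ∀ {p q} → p ℚ.≤ q → 0ℚ ℚ.≤ q - p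
p≤q⇒0≤q-p {p} {q} p≤q = subst (ℚ._≤ q - p) (ℚP.+-inverseʳ p) (ℚP.+-monoˡ-≤ (- p) p≤q)

p≤q⇒p-q≤0 : ∀ {p q} → p ℚ.≤ q → p - q ℚ.≤ 0ℚ
p≤q⇒p-q≤0 {p} {q} p≤q = subst (p - q ℚ.≤_) (ℚP.+-inverseʳ q) (ℚP.+-monoˡ-≤ (- q) p≤q)

p≤p+q : ∀ p {q} → 0ℚ ℚ.≤ q → p ℚ.≤ p + q
p≤p+q p 0≤q = subst (ℚ._≤ p + _) (ℚP.+-identityʳ p) (ℚP.+-monoʳ-≤ p 0≤q)

f[S∪⁅e⁆]≡f[S]+gain : ∀ {N} (f : Subset N → ℚ) S e → f (S ∪ ⁅ e ⁆) ≡ f S + gain f S e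
f[S∪⁅e⁆]≡f[S]+gain f S e = solve 2 (λ x y → x := y :+ (x :- y)) refl (f (S ∪ ⁅ e ⁆)) (f S)
  where open +-*-Solver using (solve; _:=_; _:+_; _:-_)

module _ {N : ℕ} {f : Subset N → ℚ} (mono : Monotone f) where

  gain-nonneg : ∀ S e → 0ℚ ℚ.≤ gain f S e
  gain-nonneg S e = p≤q⇒0≤q-p (mono S (S ∪ ⁅ e ⁆) (p⊆p∪q ⁅ e ⁆))

  gain-nonpos : ∀ {S e} → e ∈ S → gain f S e ℚ.≤ 0ℚ
  gain-nonpos e∈S = p≤q⇒p-q≤0 (mono _ _ (x∈p⇒p∪⁅x⁆⊆p e∈S))

  gain-antitone : Submodular f → ∀ {S T e} → S ⊆ T → gain f T e ℚ.≤ gain f S e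
  gain-antitone sub {S} {T} {e} S⊆T with e ∈? T
  ... | yes e∈T = ℚP.≤-trans (gain-nonpos e∈T) (gain-nonneg S e)
  ... | no  e∉T = sub S T e S⊆T e∉T

module _ {N ℓ : ℕ} (grp : Fin N → Fin ℓ) where

  OnePerGroup : Subset N → Set
  OnePerGroup S = ∀ x y → x ∈ S → y ∈ S → grp x ≡ grp y → x ≡ y

  onePerGroup-⊆ : ∀ {S T} → T ⊆ S → OnePerGroup S → OnePerGroup T
  onePerGroup-⊆ T⊆S S-one x y x∈T y∈T = S-one x y (T⊆S x∈T) (T⊆S y∈T)

  onePerGroup-∪⁅⁆ : ∀ {S s} → OnePerGroup S → Untouched grp S (grp s) → OnePerGroup (S ∪ ⁅ s ⁆)
  onePerGroup-∪⁅⁆ S-one s-untouched x y x∈ y∈ same with x∈p∪⁅y⁆⁻ x∈ | x∈p∪⁅y⁆⁻ y∈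
  ... | inj₁ x∈S | inj₁ y∈S = S-one x y x∈S y∈S same
  ... | inj₁ x∈S | inj₂ refl = contradiction same (s-untouched x x∈S)
  ... | inj₂ refl | inj₁ y∈S = contradiction (sym same) (s-untouched y y∈S)
  ... | inj₂ refl | inj₂ refl = refl

  untouched-∅ : ∀ {j} → Untouched grp ∅ j
  untouched-∅ _ x∈∅ = contradiction x∈∅ ∉⊥

  untouched? : ∀ S j → Dec (Untouched grp S j)
  untouched? S j = all? λ x → x ∈? S →-dec ¬? (grp x ≟ᶠ j)

  untouched-∪⁅⁆ : ∀ {S s j} → Untouched grp S j → grp s ≢ j → Untouched grp (S ∪ ⁅ s ⁆) j
  untouched-∪⁅⁆ j-untouched s∉j x x∈ with x∈p∪⁅y⁆⁻ x∈
  ... | inj₁ x∈S = j-untouched x x∈S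
  ... | inj₂ refl = s∉j

  InTouchedGroups : Subset N → Subset N → Set
  InTouchedGroups S O = ∀ x → x ∈ O → ¬ Untouched grp S (grp x)

  inTouchedGroups-─ : ∀ {S s O o} → OnePerGroup O → o ∈ O → Untouched grp S (grp o)
                    → InTouchedGroups (S ∪ ⁅ s ⁆) O → InTouchedGroups S (O ─ ⁅ o ⁆)
  inTouchedGroups-─ {S} {s} {O} {o} O-one o∈O o-untouched touched x x∈O-o x-untouched
    with grp s ≟ᶠ grp x
  ... | no  s∉x = touched x (p─q⊆p O ⁅ o ⁆ x∈O-o) (untouched-∪⁅⁆ x-untouched s∉x)
  ... | yes s∈x = touched o o∈O (untouched-∪⁅⁆ o-untouched (x∉o ∘ trans (sym s∈x)))
    where
    x∉o : grp x ≢ grp o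
    x∉o = x∈p-y⇒x≢y x∈O-o ∘ O-one x o (p─q⊆p O ⁅ o ⁆ x∈O-o) o∈O

module _ {N ℓ : ℕ} {f : Subset N → ℚ} {grp : Fin N → Fin ℓ} {g : Subset N → Fin ℓ → Fin N}
         (g-in-group : ∀ S i → grp (g S i) ≡ i) where

  greedyRun-feasible : ∀ {m S} → GreedyRun f grp g m S → Feasible grp m S
  greedyRun-feasible start = ℕP.≤-reflexive (∣⊥∣≡0 N) , λ x _ x∈∅ → contradiction x∈∅ ∉⊥
  greedyRun-feasible (step {S = S} run (i , i-untouched , refl , _))
    with greedyRun-feasible run
  ... | ∣S∣≤m , S-one =
    ℕP.≤-trans (∣p∪⁅x⁆∣≤1+∣p∣ S (g S i)) (s≤s ∣S∣≤m) ,
    onePerGroup-∪⁅⁆ grp S-one (subst (Untouched grp S) (sym (g-in-group S i)) i-untouched)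

  greedyStep-exists : ∀ S → ∃ (Untouched grp S) → ∃ (GreedyStep f grp g S)
  greedyStep-exists S (i₀ , i₀-untouched) =
    S ∪ ⁅ g S i ⁆ , i ,
    argmax-all greedyGain i₀-untouched (all-filter (untouched? grp S) (allFin ℓ)) , refl ,
    λ j j-untouched → lookup (f[xs]≤f[argmax] i₀ candidates)
                             (∈-filter⁺ (untouched? grp S) (∈-allFin j) j-untouched)
    where
    open Data.List.Extrema (DecTotalOrder.totalOrder ℚP.≤-decTotalOrder)
    greedyGain : Fin ℓ → ℚ
    greedyGain j = gain f S (g S j)
    candidates : List (Fin ℓ)
    candidates = filter (untouched? grp S) (allFin ℓ)
    i : Fin ℓ
    i = argmax greedyGain i₀ candidates

  -- G over-approximates the groups touched so far; while ∣ G ∣ < ℓ a group is left untouched.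
  greedyRun-exists : ∀ {m} → m ℕ.≤ ℓ
                   → ∃ λ S → GreedyRun f grp g m S
                             × ∃ λ G → ∣ G ∣ ℕ.≤ m × (∀ x → x ∈ S → grp x ∈ G)
  greedyRun-exists {zero} _ =
    ∅ , start , ∅ , ℕP.≤-reflexive (∣⊥∣≡0 ℓ) , λ _ x∈∅ → contradiction x∈∅ ∉⊥
  greedyRun-exists {suc m} 1+m≤ℓ with greedyRun-exists (ℕP.<⇒≤ 1+m≤ℓ)
  ... | S , run , G , ∣G∣≤m , S-in-G
    with ∣p∣<n⇒∃∉ G (ℕP.≤-<-trans ∣G∣≤m 1+m≤ℓ)
  ... | j , j∉G
    with greedyStep-exists S (j , λ x x∈S x∈j → j∉G (subst (_∈ G) x∈j (S-in-G x x∈S)))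
  ... | S′ , st@(i , _ , refl , _) =
    S′ , step run st , G ∪ ⁅ i ⁆ , ℕP.≤-trans (∣p∪⁅x⁆∣≤1+∣p∣ G i) (s≤s ∣G∣≤m) , S′-in-G′
    where
    S′-in-G′ : ∀ x → x ∈ S′ → grp x ∈ G ∪ ⁅ i ⁆
    S′-in-G′ x x∈S′ with x∈p∪⁅y⁆⁻ x∈S′
    ... | inj₁ x∈S = p⊆p∪q ⁅ i ⁆ (S-in-G x x∈S)
    ... | inj₂ refl = q⊆p∪q G ⁅ i ⁆ (subst (_∈ ⁅ i ⁆) (sym (g-in-group S i)) (x∈⁅x⁆ i))

module _ {N ℓ : ℕ} {f : Subset N → ℚ} {grp : Fin N → Fin ℓ} {α : ℚ}
         {g : Subset N → Fin ℓ → Fin N}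
         (mono : Monotone f) (sub : Submodular f) (0≤α : 0ℚ ℚ.≤ α)
         (oracle : IsApproxOracle f grp α g) where

  private
    α*-mono : ∀ {p q} → p ℚ.≤ q → α * p ℚ.≤ α * q
    α*-mono = ℚP.*-monoˡ-≤-nonNeg α {{ℚ.nonNegative 0≤α}}

  MarginalBound : Subset N → Subset N → Set
  MarginalBound S O = ∀ T → S ⊆ T → f (O ∪ T) ℚ.≤ f T + α * (f S - f ∅)

  marginalBound-∅ : ∀ {O} → (∀ x → x ∉ O) → MarginalBound ∅ O
  marginalBound-∅ {O} O-empty T _ = begin
    f (O ∪ T)              ≤⟨ mono _ _ O∪T⊆T ⟩
    f T                    ≡⟨ cancel (f T) α (f ∅) ⟩
    f T + α * (f ∅ - f ∅)  ∎
    where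
    open ℚP.≤-Reasoning
    open +-*-Solver using (solve; _:=_; _:+_; _:*_; _:-_)
    cancel : ∀ t a z → t ≡ t + a * (z - z)
    cancel = solve 3 (λ t a z → t := t :+ a :* (z :- z)) refl
    O∪T⊆T : O ∪ T ⊆ T
    O∪T⊆T x∈O∪T with x∈p∪q⁻ O T x∈O∪T
    ... | inj₁ x∈O = contradiction x∈O (O-empty _)
    ... | inj₂ x∈T = x∈T

  marginalBound-mono : ∀ {S S′ O} → S ⊆ S′ → MarginalBound S O → MarginalBound S′ O
  marginalBound-mono S⊆S′ bound T S′⊆T =
    ℚP.≤-trans (bound T (S′⊆T ∘ S⊆S′))
               (ℚP.+-monoʳ-≤ (f T) (α*-mono (ℚP.+-monoˡ-≤ (- f ∅) (mono _ _ S⊆S′))))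

  module _ {S : Subset N} {i : Fin ℓ}
           (i-best : ∀ j → Untouched grp S j → gain f S (g S j) ℚ.≤ gain f S (g S i)) where

    gain≤α*greedyGain : ∀ {T o} → S ⊆ T → Untouched grp S (grp o)
                      → gain f T o ℚ.≤ α * gain f S (g S i)
    gain≤α*greedyGain {T} {o} S⊆T o-untouched = begin
      gain f T o                  ≤⟨ gain-antitone mono sub S⊆T ⟩
      gain f S o                  ≤⟨ proj₂ (oracle S (grp o)) o refl ⟩
      α * gain f S (g S (grp o))  ≤⟨ α*-mono (i-best (grp o) o-untouched) ⟩
      α * gain f S (g S i)        ∎
      where open ℚP.≤-Reasoning

    marginalBound-insert : ∀ {O o} → Untouched grp S (grp o)
                         → MarginalBound S (O ─ ⁅ o ⁆) → MarginalBound (S ∪ ⁅ g S i ⁆) O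
    marginalBound-insert {O} {o} o-untouched bound T S′⊆T = begin
      f (O ∪ T)                                   ≤⟨ mono _ _ (p∪q⊆[p-x∪q]∪⁅x⁆ O T o) ⟩
      f (X ∪ ⁅ o ⁆)                               ≡⟨ f[S∪⁅e⁆]≡f[S]+gain f X o ⟩
      f X + gain f X o                            ≤⟨ ℚP.+-mono-≤ (bound T S⊆T) gain-o ⟩
      (f T + α * (f S - f ∅)) + α * (f S′ - f S)  ≡⟨ telescope (f T) α (f ∅) (f S) (f S′) ⟩
      f T + α * (f S′ - f ∅)                      ∎
      where
      open ℚP.≤-Reasoning
      open +-*-Solver using (solve; _:=_; _:+_; _:*_; _:-_)
      S′ : Subset N
      S′ = S ∪ ⁅ g S i ⁆
      X : Subset N
      X = (O ─ ⁅ o ⁆) ∪ T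
      S⊆T : S ⊆ T
      S⊆T = S′⊆T ∘ p⊆p∪q ⁅ g S i ⁆
      gain-o : gain f X o ℚ.≤ α * (f S′ - f S)
      gain-o = ℚP.≤-trans (gain-antitone mono sub (q⊆p∪q _ T))
                          (gain≤α*greedyGain S⊆T o-untouched)
      telescope : ∀ t a z s s′ → (t + a * (s - z)) + a * (s′ - s) ≡ t + a * (s′ - z)
      telescope = solve 5 (λ t a z s s′ →
        (t :+ a :* (s :- z)) :+ a :* (s′ :- s) := t :+ a :* (s′ :- z)) refl

  Invariant : ℕ → Subset N → Set
  Invariant m S = ∀ {O} → OnePerGroup grp O → ∣ O ∣ ℕ.≤ m ⊎ InTouchedGroups grp S O
                → MarginalBound S O

  invariant-start : Invariant 0 ∅
  invariant-start {O} _ hyp = marginalBound-∅ λ x x∈O → Sum.[ O-nonempty x∈O , touched-∅ x x∈O ] hyp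
    where
    O-nonempty : ∀ {x} → x ∈ O → ¬ ∣ O ∣ ℕ.≤ 0
    O-nonempty x∈O ∣O∣≤0 = ℕP.n≮0 (ℕP.<-≤-trans (x∈p⇒∣p-x∣<∣p∣ x∈O) ∣O∣≤0)
    touched-∅ : ∀ x → x ∈ O → ¬ InTouchedGroups grp ∅ O
    touched-∅ x x∈O touched = touched x x∈O (untouched-∅ grp)

  invariant-step : ∀ {m S i} → (∀ j → Untouched grp S j → gain f S (g S j) ℚ.≤ gain f S (g S i))
                 → Invariant m S → Invariant (suc m) (S ∪ ⁅ g S i ⁆)
  invariant-step {m} {S} i-best inv {O} O-one hyp
    with any? (λ o → o ∈? O ×-dec untouched? grp S (grp o))
  ... | no none =
    marginalBound-mono (p⊆p∪q _) (inv O-one (inj₂ λ x x∈O x-untouched → none (x , x∈O , x-untouched)))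
  ... | yes (o , o∈O , o-untouched) =
    marginalBound-insert i-best o-untouched
      (inv (onePerGroup-⊆ grp (p─q⊆p O ⁅ o ⁆) O-one)
           (Sum.map shrink (inTouchedGroups-─ grp O-one o∈O o-untouched) hyp))
    where
    shrink : ∣ O ∣ ℕ.≤ suc m → ∣ O ─ ⁅ o ⁆ ∣ ℕ.≤ m
    shrink ∣O∣≤1+m = ℕP.≤-pred (ℕP.≤-trans (x∈p⇒∣p-x∣<∣p∣ o∈O) ∣O∣≤1+m)

  greedyRun-invariant : ∀ {m S} → GreedyRun f grp g m S → Invariant m S
  greedyRun-invariant start = invariant-start
  greedyRun-invariant (step run (_ , _ , refl , i-best)) =
    invariant-step i-best (greedyRun-invariant run)

  greedyRun-approximation : NonNegative f → ∀ {k S O} → GreedyRun f grp g k S → Feasible grp k O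
                          → f O ℚ.≤ (α + 1ℚ) * f S
  greedyRun-approximation nonneg {S = S} {O} run (∣O∣≤k , O-one) = begin
    f O                              ≤⟨ mono _ _ (p⊆p∪q S) ⟩
    f (O ∪ S)                        ≤⟨ greedyRun-invariant run O-one (inj₁ ∣O∣≤k) S (λ x∈S → x∈S) ⟩
    f S + α * (f S - f ∅)            ≤⟨ p≤p+q _ 0≤α*f[∅] ⟩
    f S + α * (f S - f ∅) + α * f ∅  ≡⟨ collect (f S) α (f ∅) ⟩
    (α + 1ℚ) * f S                   ∎
    where
    open ℚP.≤-Reasoning
    open +-*-Solver using (solve; _:=_; _:+_; _:*_; _:-_; con)
    collect : ∀ s a z → s + a * (s - z) + a * z ≡ (a + 1ℚ) * s
    collect = solve 3 (λ s a z → s :+ a :* (s :- z) :+ a :* z := (a :+ con 1ℚ) :* s) refl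
    0≤α*f[∅] : 0ℚ ℚ.≤ α * f ∅
    0≤α*f[∅] = subst (ℚ._≤ α * f ∅) (ℚP.*-zeroʳ α) (α*-mono (nonneg ∅))

lemma3 : (N ℓ k : ℕ) (f : Subset N → ℚ) (grp : Fin N → Fin ℓ)
         (α : ℚ) (g : Subset N → Fin ℓ → Fin N)
       → NonNegative f → Monotone f → Submodular f
       → k ℕ.< ℓ → 1ℚ ℚ.≤ α
       → IsApproxOracle f grp α g
       → (Σ (Subset N) λ S → GreedyRun f grp g k S)
         × (∀ S → GreedyRun f grp g k S
              → Feasible grp k S
                × (∀ O → Feasible grp k O → (∀ T → Feasible grp k T → f T ℚ.≤ f O)
                     → f O ℚ.≤ (α + 1ℚ) * f S))
lemma3 N ℓ k f grp α g nonneg mono sub k<ℓ 1≤α oracle =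
  run₀ ,
  λ S run → greedyRun-feasible g-in-group run ,
            -- the bound holds for every feasible O, optimal or not
            λ O O-feasible _ → greedyRun-approximation mono sub 0≤α oracle nonneg run O-feasible
  where
  g-in-group : ∀ S i → grp (g S i) ≡ i
  g-in-group S i = proj₁ (oracle S i)
  0≤α : 0ℚ ℚ.≤ α
  0≤α = ℚP.≤-trans (ℚP.nonNegative⁻¹ 1ℚ) 1≤α
  run₀ : Σ (Subset N) (GreedyRun f grp g k)
  run₀ = Product.map₂ proj₁ (greedyRun-exists g-in-group (ℕP.<⇒≤ k<ℓ))
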